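{- Let $n$ be a positive integer and let $\mathbf{M}$ be a good $n\times n$ matrix. For $j=1,\dots,n$ let $G_j$ be the complete bipartite graph on vertex set a subset of $[2n]=\{1,\dots,2n\}$ with colour classes $A_j,B_j$ defined as follows: for each $i\in[n]$, if $\mathbf{M}_{ij}=0$ neither $2i-1$ nor $2i$ is in $A_j\cup B_j$; if $\mathbf{M}_{ij}=1$ then $2i\in B_j$ and $2i-1\in A_j$; if $\mathbf{M}_{ij}=-1$ then $2i\in A_j$ and $2i-1\in B_j$. Then $G_1,\dots,G_n$ form an odd cover of $K_{2n}$ (on vertex set $[2n]$).
   Context: An $n\times n$ matrix with entries in $\{ -1,0,1\}$ is good if: (1) every row has an odd number of non-zero entries; (2) for every pair of distinct rows, the number of columns in which both have non-zero entries is congruent to $2 \bmod 4$; (3) any two distinct rows are orthogonal over the integers. An odd cover of $K_m$ by complete bipartite graphs is a family of complete bipartite graphs on subsets of the vertex set such that every edge of $K_m$ is an edge of an odd number of them. -}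

module Defs where

open import Data.Nat using (ℕ; zero; suc; _+_; _*_; _%_; _≡ᵇ_; _≤_)
open import Data.Bool using (Bool; true; false; _∧_; _∨_; if_then_else_)
open import Data.Fin using (Fin; toℕ)
open import Data.List using (List; length; filterᵇ; foldr; map)
open import Data.Bool.ListAction using (any)
open import Data.List.Base using (allFin)
open import Data.Integer using (ℤ) renaming (_+_ to _+ℤ_; _*_ to _*ℤ_; +_ to +ℤ_; -_ to -ℤ_)
open import Relation.Binary.PropositionalEquality using (_≡_; _≢_)

data Entry : Set where
  neg zer pos : Entry

toℤ : Entry → ℤ
toℤ neg = -ℤ (+ℤ 1)
toℤ zer = +ℤ 0
toℤ pos = +ℤ 1

nonzero : Entry → Bool
nonzero zer = false
nonzero _   = true

isPos : Entry → Bool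
isPos pos = true
isPos _   = false

isNeg : Entry → Bool
isNeg neg = true
isNeg _   = false

-- n × n matrix with entries in {-1,0,1}; M i c = entry in row i, column c
Matrix : ℕ → Set
Matrix n = Fin n → Fin n → Entry

count : {n : ℕ} → (Fin n → Bool) → ℕ
count {n} p = length (filterᵇ p (allFin n))

sumℤ : {n : ℕ} → (Fin n → ℤ) → ℤ
sumℤ {n} f = foldr _+ℤ_ (+ℤ 0) (map f (allFin n))

record Good {n : ℕ} (M : Matrix n) : Set where
  field
    oddRows : ∀ (i : Fin n) → count (λ c → nonzero (M i c)) % 2 ≡ 1
    commonNonzero : ∀ (i k : Fin n) → i ≢ k → count (λ c → nonzero (M i c) ∧ nonzero (M k c)) % 4 ≡ 2
    orthogonal : ∀ (i k : Fin n) → i ≢ k → sumℤ (λ c → toℤ (M i c) *ℤ toℤ (M k c)) ≡ +ℤ 0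

-- Colour classes of G_j, vertices in [2n] = {1,…,2n} as natural numbers.
-- Row i : Fin n corresponds to paper index i+1, i.e. vertices 2(i+1)-1 = 2i+1 and 2(i+1) = 2i+2.
inA : {n : ℕ} → Matrix n → Fin n → ℕ → Bool
inA {n} M j v = any (λ i → ((v ≡ᵇ (2 * toℕ i + 1)) ∧ isPos (M i j))
                          ∨ ((v ≡ᵇ (2 * toℕ i + 2)) ∧ isNeg (M i j))) (allFin n)

inB : {n : ℕ} → Matrix n → Fin n → ℕ → Bool
inB {n} M j v = any (λ i → ((v ≡ᵇ (2 * toℕ i + 2)) ∧ isPos (M i j))
                          ∨ ((v ≡ᵇ (2 * toℕ i + 1)) ∧ isNeg (M i j))) (allFin n)

isEdgeOfG : {n : ℕ} → Matrix n → Fin n → ℕ → ℕ → Bool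
isEdgeOfG M j u v = (inA M j u ∧ inB M j v) ∨ (inB M j u ∧ inA M j v)

OddCoverK2n : {n : ℕ} → Matrix n → Set
OddCoverK2n {n} M = ∀ (u v : ℕ) → 1 ≤ u → u ≤ 2 * n → 1 ≤ v → v ≤ 2 * n → u ≢ v →
  count (λ j → isEdgeOfG M j u v) % 2 ≡ 1

-- Index the vertices of K_2n by (i, r) ∈ Fin n × Fin 2.  Vertex (i, r) lies in one class of
-- G_j or the other according to the sign of M i j, and r exchanges the two classes.  Hence the
-- edge {(i, r), (k, s)} lies in
--   * (i = k, r ≠ s) as many G_j as row i has nonzero entries, an odd number;
--   * (i ≠ k, r = s) as many G_j as there are columns j with M i j · M k j = -1;
--   * (i ≠ k, r ≠ s) as many G_j as there are columns j with M i j · M k j = +1.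
-- Orthogonality of rows i and k makes the last two numbers equal, and their sum is the size of
-- the common support, which is 2 mod 4; so each of them is odd.
module Submission where

open import Defs
open import Data.Bool using (Bool; true; false; _∧_; _∨_; T)
open import Data.Bool.Properties using (∨-identityʳ; ∨-comm)
open import Data.Bool.ListAction using (any; or)
open import Data.Empty using (⊥-elim)
open import Data.Fin as Fin using (Fin; zero; suc; toℕ; fromℕ<; combine; remQuot; opposite)
open import Data.Fin.Properties
  using (toℕ-injective; suc-injective; toℕ-combine; toℕ-fromℕ<; combine-remQuot; combine-injectiveˡ; combine-injectiveʳ)
open import Data.Integer as ℤ using (ℤ; +_)
import Data.Integer.Properties as ℤ
open import Data.Integer.Tactic.RingSolver using (solve-∀)
open import Data.List using (List; []; _∷_; length; filterᵇ; foldr; map; tabulate; allFin)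
open import Data.List.Properties using (map-cong; map-tabulate; filter-≐)
open import Data.Nat as ℕ using (ℕ; suc; _+_; _*_; _%_; _≡ᵇ_; _≤_)
import Data.Nat.Properties as ℕ
open import Data.Nat.DivMod using (m%n*o≡m*o%[n*o])
open import Data.Product using (_×_; _,_; proj₁; proj₂; ∃₂)
open import Function using (_∘_; id)
open import Relation.Binary.PropositionalEquality
open import Relation.Nullary using (¬_; yes; no)
open import Relation.Nullary.Decidable using (dec-true; dec-false; T?)

negate : Entry → Entry
negate neg = pos
negate zer = zer
negate pos = neg

infixl 7 _·_

_·_ : Entry → Entry → Entry
neg · f = negate f
zer · f = zer
pos · f = f

toℤ-· : ∀ e f → toℤ (e · f) ≡ toℤ e ℤ.* toℤ f
toℤ-· neg neg = refl
toℤ-· neg zer = refl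
toℤ-· neg pos = refl
toℤ-· zer neg = refl
toℤ-· zer zer = refl
toℤ-· zer pos = refl
toℤ-· pos neg = refl
toℤ-· pos zer = refl
toℤ-· pos pos = refl

nonzero-· : ∀ e f → nonzero (e · f) ≡ nonzero e ∧ nonzero f
nonzero-· neg neg = refl
nonzero-· neg zer = refl
nonzero-· neg pos = refl
nonzero-· zer f   = refl
nonzero-· pos f   = refl

isNeg-· : ∀ e f → (isPos e ∧ isNeg f) ∨ (isNeg e ∧ isPos f) ≡ isNeg (e · f)
isNeg-· neg neg = refl
isNeg-· neg zer = refl
isNeg-· neg pos = refl
isNeg-· zer f   = refl
isNeg-· pos f   = ∨-identityʳ (isNeg f)

isPos-· : ∀ e f → (isPos e ∧ isPos f) ∨ (isNeg e ∧ isNeg f) ≡ isPos (e · f)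
isPos-· neg neg = refl
isPos-· neg zer = refl
isPos-· neg pos = refl
isPos-· zer f   = refl
isPos-· pos f   = ∨-identityʳ (isPos f)

isPos-·-self : ∀ e → isPos (e · e) ≡ nonzero e
isPos-·-self neg = refl
isPos-·-self zer = refl
isPos-·-self pos = refl

_⊙_ : ∀ {n} → (Fin n → Entry) → (Fin n → Entry) → Fin n → Entry
(a ⊙ b) c = a c · b c

module _ {A : Set} (h : A → Entry) where

  #[_] : (Entry → Bool) → List A → ℕ
  #[ p ] xs = length (filterᵇ (p ∘ h) xs)

  Σtoℤ : List A → ℤ
  Σtoℤ xs = foldr ℤ._+_ (+ 0) (map (toℤ ∘ h) xs)

  #nonzero≡#pos+#neg : ∀ xs → #[ nonzero ] xs ≡ #[ isPos ] xs + #[ isNeg ] xs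
  #nonzero≡#pos+#neg []       = refl
  #nonzero≡#pos+#neg (x ∷ xs) with h x | #nonzero≡#pos+#neg xs
  ... | neg | ih = trans (cong suc ih) (sym (ℕ.+-suc (#[ isPos ] xs) (#[ isNeg ] xs)))
  ... | zer | ih = ih
  ... | pos | ih = cong suc ih

  Σtoℤ+#neg≡#pos : ∀ xs → Σtoℤ xs ℤ.+ + #[ isNeg ] xs ≡ + #[ isPos ] xs
  Σtoℤ+#neg≡#pos []       = refl
  Σtoℤ+#neg≡#pos (x ∷ xs) with h x | Σtoℤ+#neg≡#pos xs
  ... | neg | ih = trans (cancel (Σtoℤ xs) (+ #[ isNeg ] xs)) ih
    where
    cancel : ∀ s c → (ℤ.- + 1 ℤ.+ s) ℤ.+ (+ 1 ℤ.+ c) ≡ s ℤ.+ c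
    cancel = solve-∀
  ... | zer | ih = trans (cong (ℤ._+ + #[ isNeg ] xs) (ℤ.+-identityˡ (Σtoℤ xs))) ih
  ... | pos | ih = trans (ℤ.+-assoc (+ 1) (Σtoℤ xs) (+ #[ isNeg ] xs)) (cong (ℤ._+_ (+ 1)) ih)

count-cong : ∀ {n} {p q : Fin n → Bool} → (∀ c → p c ≡ q c) → count p ≡ count q
count-cong {n} p≗q = cong length (filter-≐ (T? ∘ _) (T? ∘ _)
  ((λ {c} → subst T (p≗q c)) , (λ {c} → subst T (sym (p≗q c)))) (allFin n))

count-nonzero : ∀ {n} (h : Fin n → Entry) → count (nonzero ∘ h) ≡ count (isPos ∘ h) + count (isNeg ∘ h)
count-nonzero {n} h = #nonzero≡#pos+#neg h (allFin n)

orthogonal⇒balanced : ∀ {n} (a b : Fin n → Entry) → sumℤ (λ c → toℤ (a c) ℤ.* toℤ (b c)) ≡ + 0 →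
                      count (isNeg ∘ (a ⊙ b)) ≡ count (isPos ∘ (a ⊙ b))
orthogonal⇒balanced {n} a b orth = ℤ.+-injective
  (trans (cong (ℤ._+ + count (isNeg ∘ (a ⊙ b))) (sym sum≡0)) (Σtoℤ+#neg≡#pos (a ⊙ b) (allFin n)))
  where
  sum≡0 : Σtoℤ (a ⊙ b) (allFin n) ≡ + 0
  sum≡0 = trans (cong (foldr ℤ._+_ (+ 0)) (map-cong (λ c → toℤ-· (a c) (b c)) (allFin n))) orth

[m+m]%4≡2⇒m%2≡1 : ∀ m → (m + m) % 4 ≡ 2 → m % 2 ≡ 1
[m+m]%4≡2⇒m%2≡1 m eq = ℕ.*-cancelʳ-≡ (m % 2) 1 2 (begin
  m % 2 * 2    ≡⟨ m%n*o≡m*o%[n*o] m 2 2 ⟩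
  m * 2 % 4    ≡⟨ cong (_% 4) (ℕ.*-comm m 2) ⟩
  2 * m % 4    ≡⟨ cong (λ x → (m + x) % 4) (ℕ.+-identityʳ m) ⟩
  (m + m) % 4  ≡⟨ eq ⟩
  2            ∎)
  where open ≡-Reasoning

sign-counts-odd : ∀ {n} {M : Matrix n} → Good M → ∀ {i k} → i ≢ k →
                  count (isPos ∘ (M i ⊙ M k)) % 2 ≡ 1 × count (isNeg ∘ (M i ⊙ M k)) % 2 ≡ 1
sign-counts-odd {M = M} G {i} {k} i≢k = positives-odd , subst (λ m → m % 2 ≡ 1) (sym balanced) positives-odd
  where
  P : ℕ
  P = count (isPos ∘ (M i ⊙ M k))
  balanced : count (isNeg ∘ (M i ⊙ M k)) ≡ P
  balanced = orthogonal⇒balanced (M i) (M k) (Good.orthogonal G i k i≢k)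
  common-support : count (λ c → nonzero (M i c) ∧ nonzero (M k c)) ≡ P + P
  common-support = begin
    count (λ c → nonzero (M i c) ∧ nonzero (M k c))  ≡⟨ count-cong (λ c → sym (nonzero-· (M i c) (M k c))) ⟩
    count (nonzero ∘ (M i ⊙ M k))                    ≡⟨ count-nonzero (M i ⊙ M k) ⟩
    P + count (isNeg ∘ (M i ⊙ M k))                  ≡⟨ cong (_+_ P) balanced ⟩
    P + P                                            ∎
    where open ≡-Reasoning
  positives-odd : P % 2 ≡ 1
  positives-odd = [m+m]%4≡2⇒m%2≡1 P (trans (cong (_% 4) (sym common-support)) (Good.commonNonzero G i k i≢k))

-- Vertex 2i + 1 + r of [2n], i.e. the paper's vertex 2i' - 1 + r for its row i' = i + 1.
vertex : ∀ {n} → Fin n → Fin 2 → ℕ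
vertex i r = suc (toℕ (combine i r))

vertex-spec : ∀ {n} (i : Fin n) r → vertex i r ≡ 2 * toℕ i + suc (toℕ r)
vertex-spec i r = trans (cong suc (toℕ-combine i r)) (sym (ℕ.+-suc _ _))

vertex-injective : ∀ {n} {i k : Fin n} {r s} → vertex i r ≡ vertex k s → i ≡ k × r ≡ s
vertex-injective {i = i} {k} {r} {s} eq =
  combine-injectiveˡ i r k s combine≡ , combine-injectiveʳ i r k s combine≡
  where
  combine≡ : combine i r ≡ combine k s
  combine≡ = toℕ-injective (ℕ.suc-injective eq)

vertex-surjective : ∀ {n} u → 1 ≤ u → u ≤ 2 * n → ∃₂ λ (i : Fin n) r → vertex i r ≡ u
vertex-surjective {n} (suc w) _ w<2n =
  proj₁ (remQuot {n} 2 x) , proj₂ (remQuot {n} 2 x) ,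
  cong suc (trans (cong toℕ (combine-remQuot {n} 2 x)) (toℕ-fromℕ< w<n*2))
  where
  w<n*2 : w ℕ.< n * 2
  w<n*2 = subst (w ℕ.<_) (ℕ.*-comm 2 n) w<2n
  x : Fin (n * 2)
  x = fromℕ< w<n*2

-- does (m ℕ.≟ n) is definitionally m ≡ᵇ n.
vertex-≡ᵇ-same : ∀ {n} (i : Fin n) r → (vertex i r ≡ᵇ 2 * toℕ i + suc (toℕ r)) ≡ true
vertex-≡ᵇ-same i r =
  trans (cong (vertex i r ≡ᵇ_) (sym (vertex-spec i r))) (dec-true (vertex i r ℕ.≟ vertex i r) refl)

vertex-≡ᵇ-other : ∀ {n} (i k : Fin n) r s → ¬ (k ≡ i × s ≡ r) →
                  (vertex i r ≡ᵇ 2 * toℕ k + suc (toℕ s)) ≡ false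
vertex-≡ᵇ-other i k r s ne = trans (cong (vertex i r ≡ᵇ_) (sym (vertex-spec k s)))
  (dec-false (vertex i r ℕ.≟ vertex k s) (λ eq → let i≡k , r≡s = vertex-injective eq in ne (sym i≡k , sym r≡s)))

or-tabulate-false : ∀ {n} (p : Fin n → Bool) → (∀ k → p k ≡ false) → or (tabulate p) ≡ false
or-tabulate-false {ℕ.zero} p off = refl
or-tabulate-false {suc n}  p off rewrite off zero = or-tabulate-false (p ∘ suc) (off ∘ suc)

or-tabulate-single : ∀ {n} (p : Fin n → Bool) i → (∀ k → k ≢ i → p k ≡ false) → or (tabulate p) ≡ p i
or-tabulate-single p zero off =
  trans (cong (p zero ∨_) (or-tabulate-false (p ∘ suc) (λ k → off (suc k) λ ()))) (∨-identityʳ (p zero))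
or-tabulate-single p (suc i) off rewrite off zero (λ ()) =
  or-tabulate-single (p ∘ suc) i (λ k k≢i → off (suc k) (k≢i ∘ suc-injective))

-- inA and inB both have this shape (with s = 0 and s = 1 respectively), where w k r says
-- whether the class contains vertex (k, r).
any-vertex : ∀ {n} (w : Fin n → Fin 2 → Bool) s i r →
  any (λ k → ((vertex i r ≡ᵇ 2 * toℕ k + suc (toℕ s)) ∧ w k s)
           ∨ ((vertex i r ≡ᵇ 2 * toℕ k + suc (toℕ (opposite s))) ∧ w k (opposite s)))
      (allFin n)
  ≡ w i r
any-vertex {n} w s i r =
  trans (cong or (map-tabulate id test)) (trans (or-tabulate-single test i off) (on s r))
  where
  test : Fin n → Bool
  test k = ((vertex i r ≡ᵇ 2 * toℕ k + suc (toℕ s)) ∧ w k s)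
         ∨ ((vertex i r ≡ᵇ 2 * toℕ k + suc (toℕ (opposite s))) ∧ w k (opposite s))
  off : ∀ k → k ≢ i → test k ≡ false
  off k k≢i = cong₂ (λ x y → (x ∧ w k s) ∨ (y ∧ w k (opposite s)))
    (vertex-≡ᵇ-other i k r s (k≢i ∘ proj₁)) (vertex-≡ᵇ-other i k r (opposite s) (k≢i ∘ proj₁))
  on : ∀ s r → ((vertex i r ≡ᵇ 2 * toℕ i + suc (toℕ s)) ∧ w i s)
             ∨ ((vertex i r ≡ᵇ 2 * toℕ i + suc (toℕ (opposite s))) ∧ w i (opposite s))
             ≡ w i r
  on zero zero = trans (cong₂ (λ x y → (x ∧ w i zero) ∨ (y ∧ w i (suc zero)))
    (vertex-≡ᵇ-same i zero) (vertex-≡ᵇ-other i i zero (suc zero) λ { (_ , ()) })) (∨-identityʳ (w i zero))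
  on zero (suc zero) = cong₂ (λ x y → (x ∧ w i zero) ∨ (y ∧ w i (suc zero)))
    (vertex-≡ᵇ-other i i (suc zero) zero λ { (_ , ()) }) (vertex-≡ᵇ-same i (suc zero))
  on (suc zero) zero = cong₂ (λ x y → (x ∧ w i (suc zero)) ∨ (y ∧ w i zero))
    (vertex-≡ᵇ-other i i zero (suc zero) λ { (_ , ()) }) (vertex-≡ᵇ-same i zero)
  on (suc zero) (suc zero) = trans (cong₂ (λ x y → (x ∧ w i (suc zero)) ∨ (y ∧ w i zero))
    (vertex-≡ᵇ-same i (suc zero)) (vertex-≡ᵇ-other i i (suc zero) zero λ { (_ , ()) })) (∨-identityʳ (w i (suc zero)))

sideA sideB : Entry → Fin 2 → Bool
sideA e zero       = isPos e
sideA e (suc zero) = isNeg e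
sideB e zero       = isNeg e
sideB e (suc zero) = isPos e

inA-vertex : ∀ {n} (M : Matrix n) j i r → inA M j (vertex i r) ≡ sideA (M i j) r
inA-vertex M j = any-vertex (λ k → sideA (M k j)) zero

inB-vertex : ∀ {n} (M : Matrix n) j i r → inB M j (vertex i r) ≡ sideB (M i j) r
inB-vertex M j = any-vertex (λ k → sideB (M k j)) (suc zero)

edge-vertex : ∀ {n} (M : Matrix n) j i r k s → isEdgeOfG M j (vertex i r) (vertex k s)
              ≡ (sideA (M i j) r ∧ sideB (M k j) s) ∨ (sideB (M i j) r ∧ sideA (M k j) s)
edge-vertex M j i r k s = cong₂ _∨_ (cong₂ _∧_ (inA-vertex M j i r) (inB-vertex M j k s))
                                    (cong₂ _∧_ (inB-vertex M j i r) (inA-vertex M j k s))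

edge-parallel : ∀ {n} (M : Matrix n) i k r j → isEdgeOfG M j (vertex i r) (vertex k r) ≡ isNeg (M i j · M k j)
edge-parallel M i k zero       j = trans (edge-vertex M j i zero k zero) (isNeg-· (M i j) (M k j))
edge-parallel M i k (suc zero) j = trans (edge-vertex M j i (suc zero) k (suc zero))
  (trans (∨-comm (isNeg (M i j) ∧ isPos (M k j)) _) (isNeg-· (M i j) (M k j)))

edge-crossing : ∀ {n} (M : Matrix n) i k {r s} → r ≢ s → ∀ j →
                isEdgeOfG M j (vertex i r) (vertex k s) ≡ isPos (M i j · M k j)
edge-crossing M i k {zero}     {zero}     r≢s j = ⊥-elim (r≢s refl)
edge-crossing M i k {zero}     {suc zero} _   j = trans (edge-vertex M j i zero k (suc zero)) (isPos-· (M i j) (M k j))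
edge-crossing M i k {suc zero} {zero}     _   j = trans (edge-vertex M j i (suc zero) k zero)
  (trans (∨-comm (isNeg (M i j) ∧ isNeg (M k j)) _) (isPos-· (M i j) (M k j)))
edge-crossing M i k {suc zero} {suc zero} r≢s j = ⊥-elim (r≢s refl)

edge-count-odd : ∀ {n} {M : Matrix n} → Good M → ∀ i r k s → vertex i r ≢ vertex k s →
                 count (λ j → isEdgeOfG M j (vertex i r) (vertex k s)) % 2 ≡ 1
edge-count-odd {M = M} G i r k s ne with r Fin.≟ s | i Fin.≟ k
... | yes refl | yes refl = ⊥-elim (ne refl)
... | yes refl | no i≢k   =
  trans (cong (_% 2) (count-cong (edge-parallel M i k r))) (proj₂ (sign-counts-odd G i≢k))
... | no r≢s   | no i≢k   =
  trans (cong (_% 2) (count-cong (edge-crossing M i k r≢s))) (proj₁ (sign-counts-odd G i≢k))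
... | no r≢s   | yes refl =
  trans (cong (_% 2) (count-cong λ j → trans (edge-crossing M i i r≢s j) (isPos-·-self (M i j))))
        (Good.oddRows G i)

mainTheorem12 : (n : ℕ) → 1 ≤ n → (M : Matrix n) → Good M → OddCoverK2n M
mainTheorem12 n _ M G u v 1≤u u≤2n 1≤v v≤2n u≢v =
  let i , r , [i,r]≡u = vertex-surjective u 1≤u u≤2n
      k , s , [k,s]≡v = vertex-surjective v 1≤v v≤2n
  in subst₂ (λ x y → count (λ j → isEdgeOfG M j x y) % 2 ≡ 1) [i,r]≡u [k,s]≡v
       (edge-count-odd G i r k s (u≢v ∘ subst₂ _≡_ [i,r]≡u [k,s]≡v))
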